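{- For any integers $g \ge 0$ and $p \ge 2$ such that $g \le \beta(K_p) = \frac12 (p-1)(p-2)$, there exists a spinal quadrangulation of $\Sigma_g$ with exactly $2p$ vertices.
   Context: All graphs are finite, undirected and simple. $\Sigma_g$ denotes the closed orientable surface of genus $g$. If a graph $G$ is 2-cell embedded in $\Sigma_g$, the components of $\Sigma_g - G$ are called regions. A quadrangulation of $\Sigma_g$ with graph $G$ is a 2-cell embedding $G \hookrightarrow \Sigma_g$ in which each region is bounded by a simple circuit of length 4 in $G$; its order is the number of vertices of $G$. For a connected graph $G$, $\beta(G)=|E(G)|-|V(G)|+1$; $K_p$ is the complete graph on $p$ vertices. The 2-fold interlacement $G[:]$ of $G$ is the graph whose vertex set is the disjoint union $V(G')\sqcup V(G'')$ of two disjoint copies $G', G''$ of $G$, and whose edge set consists of $E(G')\sqcup E(G'')$ together with, for each vertex $v'\in V(G')$ (copy of $v \in V(G)$), the edges joining $v'$ to each vertex $u''\in V(G'')$ such that $u$ is adjacent to $v$ in $G$. A spinal quadrangulation (with spine $G$) is any quadrangulation $G[:] \hookrightarrow \Sigma_{\beta(G)}$, where $G$ is a non-trivial connected graph. -}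

module Defs where

open import Data.Nat using (ℕ; zero; suc; _+_; _*_; _∸_; _≤_; _<ᵇ_)
open import Data.Fin using (Fin; toℕ; splitAt)
open import Data.Bool using (Bool; true; false; T; if_then_else_; _∧_)
open import Data.Product using (Σ; _×_; _,_; proj₁; proj₂; ∃-syntax)
open import Data.Sum using ([_,_])
open import Data.List using (List; map; allFin)
open import Data.Nat.ListAction using (sum)
open import Function using (id)
open import Relation.Binary.PropositionalEquality using (_≡_; _≢_; subst; cong)

record Graph (n : ℕ) : Set where
  field
    adj        : Fin n → Fin n → Bool
    adj-sym    : ∀ u v → adj u v ≡ adj v u
    adj-irrefl : ∀ v → adj v v ≡ false
open Graph public

module _ {n : ℕ} (G : Graph n) where

  edgeCount : ℕ
  edgeCount = sum (map (λ u → sum (map (λ v →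
      if (toℕ u <ᵇ toℕ v) ∧ adj G u v then 1 else 0) (allFin n))) (allFin n))

  β : ℕ
  β = (edgeCount + 1) ∸ n

  data Reach : Fin n → Fin n → Set where
    here : ∀ {v} → Reach v v
    step : ∀ {u w v} → T (adj G u w) → Reach w v → Reach u v

  Connected : Set
  Connected = ∀ u v → Reach u v

  NonTrivial : Set
  NonTrivial = 2 ≤ n

  Dart : Set
  Dart = Σ (Fin n × Fin n) (λ e → T (adj G (proj₁ e) (proj₂ e)))

  tail : Dart → Fin n
  tail d = proj₁ (proj₁ d)

  rev : Dart → Dart
  rev ((u , v) , p) = (v , u) , subst T (adj-sym G u v) p

iter : {A : Set} → (A → A) → ℕ → A → A
iter f zero    x = x
iter f (suc k) x = f (iter f k x)

module _ {n : ℕ} (G : Graph n) where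

  -- A rotation system: at every vertex v, a cyclic permutation of the darts
  -- leaving v (equivalently of the neighbours of v).  By the
  -- Heffter–Edmonds–Ringel theorem these correspond to the 2-cell embeddings of
  -- a connected graph in closed orientable surfaces.
  record RotationSystem : Set where
    field
      ρ        : Dart G → Dart G
      ρ-tail   : ∀ d → tail G (ρ d) ≡ tail G d
      ρ-inj    : ∀ d d' → proj₁ (ρ d) ≡ proj₁ (ρ d') → proj₁ d ≡ proj₁ d'
      ρ-cyclic : ∀ d d' → tail G d ≡ tail G d' →
                 ∃[ k ] proj₁ (iter ρ k d) ≡ proj₁ d'
  open RotationSystem public

  faceStep : RotationSystem → Dart G → Dart G
  faceStep R d = ρ R (rev G d)

  -- the regions: f = number of orbits of faceStep, witnessed by a surjection
  -- onto Fin f whose fibres are exactly the orbits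
  record Faces (R : RotationSystem) (f : ℕ) : Set where
    field
      face      : Dart G → Fin f
      face-surj : ∀ i → ∃[ d ] face d ≡ i
      face-orb₁ : ∀ d d' → face d ≡ face d' →
                  ∃[ k ] proj₁ (iter (faceStep R) k d) ≡ proj₁ d'
      face-orb₂ : ∀ d d' → (∃[ k ] proj₁ (iter (faceStep R) k d) ≡ proj₁ d') →
                  face d ≡ face d'

  Distinct4 : Fin n → Fin n → Fin n → Fin n → Set
  Distinct4 a b c d = a ≢ b × a ≢ c × a ≢ d × b ≢ c × b ≢ d × c ≢ d

  AllFacesSimple4 : RotationSystem → Set
  AllFacesSimple4 R = ∀ d →
      proj₁ (iter (faceStep R) 4 d) ≡ proj₁ d
    × Distinct4 (tail G d) (tail G (iter (faceStep R) 1 d))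
                (tail G (iter (faceStep R) 2 d)) (tail G (iter (faceStep R) 3 d))

  -- A quadrangulation of Σ_g with graph G: a 2-cell embedding of (connected) G
  -- in the orientable surface Σ_g (given by a rotation system, with genus g
  -- determined by Euler's formula |V| - |E| + |F| = 2 - 2g) whose regions are
  -- all bounded by simple 4-circuits.
  Quadrangulation : ℕ → Set
  Quadrangulation g =
    Connected G ×
    Σ RotationSystem λ R → Σ ℕ λ f →
      Faces R f × (n + f + 2 * g ≡ 2 + edgeCount G) × AllFacesSimple4 R

-- the 2-fold interlacement G[:] on Fin (n + n): the first n vertices are the
-- copy G', the last n the copy G''.  x ~ y iff their originals are adjacent in G
-- (edges of G', edges of G'', and the cross edges v'–u'' for u ~ v).
original : {n : ℕ} → Fin (n + n) → Fin n
original {n} x = [ id , id ] (splitAt n x)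

interlace : {n : ℕ} → Graph n → Graph (n + n)
interlace G = record
  { adj        = λ x y → adj G (original x) (original y)
  ; adj-sym    = λ x y → adj-sym G (original x) (original y)
  ; adj-irrefl = λ x → adj-irrefl G (original x)
  }

-- A spinal quadrangulation with spine G: G non-trivial connected and
-- G[:] ↪ Σ_{β(G)} a quadrangulation.  It is "of Σ_g" when β(G) = g.
SpinalQuadrangulation : {n : ℕ} → Graph n → Set
SpinalQuadrangulation G =
  NonTrivial G × Connected G × Quadrangulation (interlace G) (β G)

module Submission where

-- The proof follows the paper: for every graph G, the 2-fold interlacement
-- G[:] quadrangulates the surface of genus β(G).  Number the neighbours of
-- each vertex a cyclically.  Around a′ the rotation visits w′, w″, then the
-- previous neighbour; around a″ it visits w″, w′, then the next one.  Tracing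
-- faces, every face is a 4-circuit a′ w′ a″ c″ (c the neighbour after w), and
-- the faces correspond to the 2|E| darts of G.  With |V(G[:])| = 2n and
-- |E(G[:])| = 4|E|, Euler's formula gives genus |E| - n + 1 = β(G).
--
-- Finally a
-- connected "spine" on p vertices with exactly p - 1 + g edges is built as a
-- threshold graph, and the corollary is the embedding of its interlacement.

open import Data.Nat using (ℕ; zero; suc; _+_; _*_; _∸_; _≤_; _<_; _<ᵇ_; z≤n; s≤s; _⊓_)
open import Data.Nat.Properties
open import Data.Fin using (Fin; zero; suc; toℕ; fromℕ; inject₁; splitAt; join; _↑ˡ_; _↑ʳ_)
open import Data.Fin.Properties
  using (toℕ-↑ˡ; toℕ-↑ʳ; toℕ<n; splitAt-↑ˡ; splitAt-↑ʳ; join-splitAt; toℕ-inject₁; toℕ-fromℕ; toℕ-injective; toℕ≤pred[n])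
open import Data.Bool using (Bool; true; false; T; if_then_else_; _∧_; _∨_; not)
open import Data.Bool.Properties using (T-≡; ¬-not; ∨-comm; ∨-identityʳ; T-irrelevant)
open import Relation.Nullary.Decidable using (recompute; T?)
open import Data.Empty using (⊥-elim; ⊥-elim-irr)
open import Data.Unit using (tt)
open import Relation.Nullary using (¬_; yes; no)
open import Data.Product using (Σ; _×_; _,_; proj₁; proj₂; ∃-syntax)
open import Data.Sum using (_⊎_; inj₁; inj₂; [_,_])
open import Data.List using (tabulate; map; allFin)
open import Data.List.Properties using (map-tabulate)
open import Data.Nat.ListAction using () renaming (sum to listSum)
open import Function using (id; _∘_; Equivalence)
open import Relation.Binary.PropositionalEquality hiding ([_])
open import Relation.Binary.Definitions using (tri<; tri≈; tri>)
open import Algebra.Properties.CommutativeMonoid.Sum +-0-commutativeMonoid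
  using (sum; sum-syntax; sum-cong-≗; ∑-distrib-+; ∑-comm; sum-replicate-zero; sum-init-last)
open import Data.Nat.Solver using (module +-*-Solver)
open +-*-Solver using (solve; _:+_; _:*_; _:=_; con)
open import Defs

iter-+ : {A : Set} (f : A → A) (m k : ℕ) (x : A) → iter f (m + k) x ≡ iter f m (iter f k x)
iter-+ f zero    k x = refl
iter-+ f (suc m) k x = cong f (iter-+ f m k x)

iter-suc : {A : Set} (f : A → A) (m : ℕ) (x : A) → iter f (suc m) x ≡ iter f m (f x)
iter-suc f m x = trans (cong (λ k → iter f k x) (+-comm 1 m)) (iter-+ f m 1 x)

iter-twice : {A : Set} (f : A → A) (r : ℕ) (x : A) → iter (f ∘ f) r x ≡ iter f (r + r) x
iter-twice f zero    x = refl
iter-twice f (suc r) x = trans (cong (f ∘ f) (iter-twice f r x)) (cong (λ k → iter f k x) (sym (cong suc (+-suc r r))))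

iter-conjugate : {A B : Set} (to : B → A) (from : A → B) → (∀ x → to (from x) ≡ x) → (∀ y → from (to y) ≡ y) →
  (f : A → A) → ∀ k y → iter (from ∘ f ∘ to) k y ≡ from (iter f k (to y))
iter-conjugate to from to-from from-to f zero    y = sym (from-to y)
iter-conjugate to from to-from from-to f (suc k) y =
  cong (from ∘ f) (trans (cong to (iter-conjugate to from to-from from-to f k y)) (to-from _))

<ᵇ-true : ∀ {m k} → m < k → (m <ᵇ k) ≡ true
<ᵇ-true m<k = Equivalence.to T-≡ (<⇒<ᵇ m<k)

<ᵇ-false : ∀ {m k} → ¬ m < k → (m <ᵇ k) ≡ false
<ᵇ-false {m} {k} m≮k = ¬-not (λ eq → m≮k (<ᵇ⇒< m k (Equivalence.from T-≡ eq)))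

recover : ∀ {b} → .(T b) → T b
recover = recompute (T? _)

-- The cyclic order of Fin m.  `prev i = i - 1 (mod m)` generates the cyclic
-- group acting on Fin m; `next = prev ^ (m - 1)` is its inverse.
prev : ∀ {m} → Fin m → Fin m
prev {suc k} zero    = fromℕ k
prev {suc k} (suc i) = inject₁ i

next : ∀ {m} → Fin m → Fin m
next {suc k} = iter prev k

toℕ-iter-prev : ∀ {m} r (i : Fin m) → r ≤ toℕ i → toℕ (iter prev r i) ≡ toℕ i ∸ r
toℕ-iter-prev zero    i       _          = refl
toℕ-iter-prev (suc r) (suc i) (s≤s r≤i) = begin
    toℕ (iter prev (suc r) (suc i))  ≡⟨ cong toℕ (iter-suc prev r (suc i)) ⟩
    toℕ (iter prev r (inject₁ i))    ≡⟨ toℕ-iter-prev r (inject₁ i) (subst (r ≤_) (sym (toℕ-inject₁ i)) r≤i) ⟩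
    toℕ (inject₁ i) ∸ r              ≡⟨ cong (_∸ r) (toℕ-inject₁ i) ⟩
    toℕ i ∸ r                        ∎
  where open ≡-Reasoning

-- Walking backwards from i one reaches j after (k - j) + (i + 1) steps:
-- i steps down to 0, one step to the last element k, then k - j steps to j.
prev-walk : ∀ {k} (i j : Fin (suc k)) → iter prev ((k ∸ toℕ j) + suc (toℕ i)) i ≡ j
prev-walk {k} i j = begin
    iter prev ((k ∸ toℕ j) + suc (toℕ i)) i          ≡⟨ iter-+ prev (k ∸ toℕ j) (suc (toℕ i)) i ⟩
    iter prev (k ∸ toℕ j) (prev (iter prev (toℕ i) i)) ≡⟨ cong (iter prev (k ∸ toℕ j) ∘ prev) down-to-zero ⟩
    iter prev (k ∸ toℕ j) (fromℕ k)                   ≡⟨ toℕ-injective from-last ⟩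
    j                                                 ∎
  where
  open ≡-Reasoning
  down-to-zero : iter prev (toℕ i) i ≡ zero
  down-to-zero = toℕ-injective (trans (toℕ-iter-prev (toℕ i) i ≤-refl) (n∸n≡0 (toℕ i)))
  from-last : toℕ (iter prev (k ∸ toℕ j) (fromℕ k)) ≡ toℕ j
  from-last = begin
      toℕ (iter prev (k ∸ toℕ j) (fromℕ k))
    ≡⟨ toℕ-iter-prev (k ∸ toℕ j) (fromℕ k) (subst (k ∸ toℕ j ≤_) (sym (toℕ-fromℕ k)) (m∸n≤m k (toℕ j))) ⟩
      toℕ (fromℕ k) ∸ (k ∸ toℕ j)
    ≡⟨ cong (_∸ (k ∸ toℕ j)) (toℕ-fromℕ k) ⟩
      k ∸ (k ∸ toℕ j)
    ≡⟨ m∸[m∸n]≡n (toℕ≤pred[n] j) ⟩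
      toℕ j ∎

prev-transitive : ∀ {m} (i j : Fin m) → ∃[ r ] iter prev r i ≡ j
prev-transitive {suc k} i j = (k ∸ toℕ j) + suc (toℕ i) , prev-walk i j

prev-period : ∀ {k} (i : Fin (suc k)) → iter prev (suc k) i ≡ i
prev-period {k} i = trans (cong (λ r → iter prev r i) (sym walk-length)) (prev-walk i i)
  where
  walk-length : (k ∸ toℕ i) + suc (toℕ i) ≡ suc k
  walk-length = trans (+-suc (k ∸ toℕ i) (toℕ i)) (cong suc (m∸n+n≡m (toℕ≤pred[n] i)))

next-prev : ∀ {m} (i : Fin m) → next (prev i) ≡ i
next-prev {suc k} i = trans (sym (iter-suc prev k i)) (prev-period i)

prev-next : ∀ {m} (i : Fin m) → prev (next i) ≡ i
prev-next {suc k} i = prev-period i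

next-transitive : ∀ {m} (i j : Fin m) → ∃[ r ] iter next r i ≡ j
next-transitive i j with prev-transitive j i
... | r , prevʳj≡i = r , trans (cong (iter next r) (sym prevʳj≡i)) (undo r j)
  where
  undo : ∀ {m} r (x : Fin m) → iter next r (iter prev r x) ≡ x
  undo zero    x = refl
  undo (suc r) x = begin
      iter next (suc r) (prev (iter prev r x))  ≡⟨ iter-suc next r _ ⟩
      iter next r (next (prev (iter prev r x))) ≡⟨ cong (iter next r) (next-prev _) ⟩
      iter next r (iter prev r x)               ≡⟨ undo r x ⟩
      x                                         ∎
    where open ≡-Reasoning

turn : Bool → ∀ {m} → Fin m → Fin m
turn false = prev
turn true  = next

turn-inverse : ∀ s {m} (i : Fin m) → turn (not s) (turn s i) ≡ i
turn-inverse false i = next-prev i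
turn-inverse true  i = prev-next i

turn-transitive : ∀ s {m} (i j : Fin m) → ∃[ r ] iter (turn s) r i ≡ j
turn-transitive false = prev-transitive
turn-transitive true  = next-transitive

every-side : ∀ s t → t ≡ s ⊎ t ≡ not s
every-side false false = inj₁ refl
every-side false true  = inj₂ refl
every-side true  false = inj₂ refl
every-side true  true  = inj₁ refl

ind : Bool → ℕ
ind b = if b then 1 else 0

listSum-tabulate : ∀ {n} (f : Fin n → ℕ) → listSum (tabulate f) ≡ sum f
listSum-tabulate {zero}  f = refl
listSum-tabulate {suc n} f = cong (f zero +_) (listSum-tabulate (f ∘ suc))

listSum-allFin : ∀ {n} (f : Fin n → ℕ) → listSum (map f (allFin n)) ≡ sum f
listSum-allFin {n} f = trans (cong listSum (map-tabulate id f)) (listSum-tabulate f)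

edgeCount-∑ : ∀ {m} (H : Graph m) →
  edgeCount H ≡ ∑[ u < m ] ∑[ v < m ] ind ((toℕ u <ᵇ toℕ v) ∧ adj H u v)
edgeCount-∑ {m} H = trans (listSum-allFin {m} _) (sum-cong-≗ {m} (λ u → listSum-allFin {m} _))

sum-↑ : ∀ m {k} (h : Fin (m + k) → ℕ) → sum h ≡ ∑[ i < m ] h (i ↑ˡ k) + ∑[ j < k ] h (m ↑ʳ j)
sum-↑ zero    h = refl
sum-↑ (suc m) h = trans (cong (h zero +_) (sum-↑ m (h ∘ suc))) (sym (+-assoc (h zero) _ _))

fromΣ : ∀ {n} (d : Fin n → ℕ) → Σ (Fin n) (Fin ∘ d) → Fin (sum d)
fromΣ {suc n} d (zero  , k) = k ↑ˡ _
fromΣ {suc n} d (suc a , k) = d zero ↑ʳ fromΣ (d ∘ suc) (a , k)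

toΣ : ∀ {n} (d : Fin n → ℕ) → Fin (sum d) → Σ (Fin n) (Fin ∘ d)
toΣ {suc n} d i with splitAt (d zero) i
... | inj₁ k = zero , k
... | inj₂ j = suc (proj₁ (toΣ (d ∘ suc) j)) , proj₂ (toΣ (d ∘ suc) j)

toΣ-fromΣ : ∀ {n} (d : Fin n → ℕ) x → toΣ d (fromΣ d x) ≡ x
toΣ-fromΣ {suc n} d (zero , k) rewrite splitAt-↑ˡ (d zero) k (sum (d ∘ suc)) = refl
toΣ-fromΣ {suc n} d (suc a , k)
  rewrite splitAt-↑ʳ (d zero) (sum (d ∘ suc)) (fromΣ (d ∘ suc) (a , k))
        | toΣ-fromΣ (d ∘ suc) (a , k) = refl

fromΣ-toΣ : ∀ {n} (d : Fin n → ℕ) i → fromΣ d (toΣ d i) ≡ i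
fromΣ-toΣ {suc n} d i with splitAt (d zero) i in eq
... | inj₁ k = trans (cong (join (d zero) _) (sym eq)) (join-splitAt (d zero) _ i)
... | inj₂ j = trans (cong (d zero ↑ʳ_) (fromΣ-toΣ (d ∘ suc) j))
                     (trans (cong (join (d zero) _) (sym eq)) (join-splitAt (d zero) _ i))

count : ∀ {n} → (Fin n → Bool) → ℕ
count P = ∑[ i < _ ] ind (P i)

-- The `-after`
-- variants treat Fin (suc n) with the value b of P at zero made explicit.
select       : ∀ {n} (P : Fin n → Bool) → Fin (count P) → Fin n
select-after : ∀ {n} (P : Fin (suc n) → Bool) b → Fin (ind b + count (P ∘ suc)) → Fin (suc n)
select {suc n} P = select-after P (P zero)
select-after P true  zero    = zero
select-after P true  (suc i) = suc (select (P ∘ suc) i)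
select-after P false i       = suc (select (P ∘ suc) i)

index       : ∀ {n} (P : Fin n → Bool) (w : Fin n) → .(T (P w)) → Fin (count P)
index-after : ∀ {n} (P : Fin (suc n) → Bool) b → P zero ≡ b →
              (w : Fin (suc n)) → .(T (P w)) → Fin (ind b + count (P ∘ suc))
index {suc n} P = index-after P (P zero) refl
index-after P true  P0 zero    Pw = zero
index-after P false P0 zero    Pw = ⊥-elim-irr (subst T P0 Pw)
index-after P true  P0 (suc w) Pw = suc (index (P ∘ suc) w Pw)
index-after P false P0 (suc w) Pw = index (P ∘ suc) w Pw

select-sat       : ∀ {n} (P : Fin n → Bool) i → T (P (select P i))
select-sat-after : ∀ {n} (P : Fin (suc n) → Bool) b → P zero ≡ b → ∀ i → T (P (select-after P b i))
select-sat {suc n} P = select-sat-after P (P zero) refl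
select-sat-after P true  P0 zero    = subst T (sym P0) tt
select-sat-after P true  P0 (suc i) = select-sat (P ∘ suc) i
select-sat-after P false P0 i       = select-sat (P ∘ suc) i

select-index       : ∀ {n} (P : Fin n → Bool) w .(Pw : T (P w)) → select P (index P w Pw) ≡ w
select-index-after : ∀ {n} (P : Fin (suc n) → Bool) b (P0 : P zero ≡ b) w .(Pw : T (P w)) →
                     select-after P b (index-after P b P0 w Pw) ≡ w
select-index {suc n} P = select-index-after P (P zero) refl
select-index-after P true  P0 zero    Pw = refl
select-index-after P false P0 zero    Pw = ⊥-elim-irr (subst T P0 Pw)
select-index-after P true  P0 (suc w) Pw = cong suc (select-index (P ∘ suc) w Pw)
select-index-after P false P0 (suc w) Pw = cong suc (select-index (P ∘ suc) w Pw)

index-select       : ∀ {n} (P : Fin n → Bool) i .(Pi : T (P (select P i))) → index P (select P i) Pi ≡ i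
index-select-after : ∀ {n} (P : Fin (suc n) → Bool) b (P0 : P zero ≡ b) i .(Pi : T (P (select-after P b i))) →
                     index-after P b P0 (select-after P b i) Pi ≡ i
index-select {suc n} P = index-select-after P (P zero) refl
index-select-after P true  P0 zero    Pi = refl
index-select-after P true  P0 (suc i) Pi = cong suc (index-select (P ∘ suc) i Pi)
index-select-after P false P0 i       Pi = index-select (P ∘ suc) i Pi

-- Coordinates on the vertex set Fin (n + n) of G[:]: `copy a false` is the
-- copy a′ of a in G′ and `copy a true` the copy a″ in G″.
copy : ∀ {n} → Fin n → Bool → Fin (n + n)
copy {n} a false = a ↑ˡ n
copy {n} a true  = n ↑ʳ a

side : ∀ {n} → Fin (n + n) → Bool
side {n} x = [ (λ _ → false) , (λ _ → true) ] (splitAt n x)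

original-copy : ∀ {n} (a : Fin n) s → original (copy a s) ≡ a
original-copy {n} a false rewrite splitAt-↑ˡ n a n = refl
original-copy {n} a true  rewrite splitAt-↑ʳ n n a = refl

side-copy : ∀ {n} (a : Fin n) s → side {n} (copy a s) ≡ s
side-copy {n} a false rewrite splitAt-↑ˡ n a n = refl
side-copy {n} a true  rewrite splitAt-↑ʳ n n a = refl

copy-coordinates : ∀ {n} (x : Fin (n + n)) → copy (original x) (side {n} x) ≡ x
copy-coordinates {n} x = by-block (splitAt n x) (join-splitAt n n x)
  where
  by-block : ∀ b → join n n b ≡ x → copy {n} ([ id , id ] b) ([ (λ _ → false) , (λ _ → true) ] b) ≡ x
  by-block (inj₁ a) eq = eq
  by-block (inj₂ a) eq = eq

copy-injective : ∀ {n} (a b : Fin n) s t → copy a s ≡ copy b t → (a , s) ≡ (b , t)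
copy-injective {n} a b s t eq =
  cong₂ _,_ (trans (sym (original-copy a s)) (trans (cong original eq) (original-copy b t)))
            (trans (sym (side-copy a s)) (trans (cong (side {n}) eq) (side-copy b t)))

handshake : ∀ {n} (G : Graph n) → ∑[ a < n ] ∑[ v < n ] ind (adj G a v) ≡ 2 * edgeCount G
handshake {n} G = begin
    ∑[ a < n ] ∑[ v < n ] ind (adj G a v)
  ≡⟨ sum-cong-≗ {n} (λ a → trans (sum-cong-≗ {n} (orientations a)) (∑-distrib-+ (forward a) (backward a))) ⟩
    ∑[ a < n ] (sum (forward a) + sum (backward a))
  ≡⟨ ∑-distrib-+ (sum ∘ forward) (sum ∘ backward) ⟩
    ∑[ a < n ] sum (forward a) + ∑[ a < n ] sum (backward a)
  ≡⟨ cong₂ _+_ (sym (edgeCount-∑ G)) backward-count ⟩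
    E + E
  ≡⟨ cong (E +_) (sym (+-identityʳ E)) ⟩
    2 * E ∎
  where
  open ≡-Reasoning
  E : ℕ
  E = edgeCount G
  forward backward : Fin n → Fin n → ℕ
  forward  a v = ind ((toℕ a <ᵇ toℕ v) ∧ adj G a v)
  backward a v = ind ((toℕ v <ᵇ toℕ a) ∧ adj G a v)
  orientations : ∀ a v → ind (adj G a v) ≡ forward a v + backward a v
  orientations a v with <-cmp (toℕ a) (toℕ v)
  ... | tri< a<v _ a≯v rewrite <ᵇ-true a<v | <ᵇ-false a≯v = sym (+-identityʳ _)
  ... | tri> a≮v _ a>v rewrite <ᵇ-true a>v | <ᵇ-false a≮v = refl
  ... | tri≈ a≮v a≡v a≯v rewrite <ᵇ-false a≮v | <ᵇ-false a≯v | toℕ-injective a≡v | adj-irrefl G v = refl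
  backward-count : ∑[ a < n ] sum (backward a) ≡ E
  backward-count = begin
      ∑[ a < n ] ∑[ v < n ] backward a v
    ≡⟨ ∑-comm backward ⟩
      ∑[ v < n ] ∑[ a < n ] ind ((toℕ v <ᵇ toℕ a) ∧ adj G a v)
    ≡⟨ sum-cong-≗ {n} (λ v → sum-cong-≗ {n} (λ a → cong (λ b → ind ((toℕ v <ᵇ toℕ a) ∧ b)) (adj-sym G a v))) ⟩
      ∑[ v < n ] ∑[ a < n ] forward v a
    ≡⟨ sym (edgeCount-∑ G) ⟩
      E ∎

<ᵇ-+ˡ : ∀ k a b → (k + a <ᵇ k + b) ≡ (a <ᵇ b)
<ᵇ-+ˡ zero    a b = refl
<ᵇ-+ˡ (suc k) a b = <ᵇ-+ˡ k a b

-- G[:] has four times as many edges as G: |E(G)| inside each copy, and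
-- 2|E(G)| between the copies (a′v″ for each ordered adjacent pair a, v).
interlace-edgeCount : ∀ {n} (G : Graph n) → edgeCount (interlace G) ≡ 4 * edgeCount G
interlace-edgeCount {n} G = begin
    edgeCount (interlace G)
  ≡⟨ edgeCount-∑ (interlace G) ⟩
    ∑[ x < n + n ] ∑[ y < n + n ] F x y
  ≡⟨ sum-↑ n (λ x → ∑[ y < n + n ] F x y) ⟩
    ∑[ u < n ] ∑[ y < n + n ] F (copy u false) y + ∑[ u < n ] ∑[ y < n + n ] F (copy u true) y
  ≡⟨ cong₂ _+_ (split-inner false) (split-inner true) ⟩
    (∑[ u < n ] ∑[ v < n ] F (copy u false) (copy v false) + ∑[ u < n ] ∑[ v < n ] F (copy u false) (copy v true))
    + (∑[ u < n ] ∑[ v < n ] F (copy u true) (copy v false) + ∑[ u < n ] ∑[ v < n ] F (copy u true) (copy v true))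
  ≡⟨ cong₂ _+_ (cong₂ _+_ (within false) (trans (sum-cong-≗ {n} (λ u → sum-cong-≗ {n} (upward u))) (handshake G)))
               (cong₂ _+_ (trans (sum-cong-≗ {n} (λ u → trans (sum-cong-≗ {n} (downward u)) (sum-replicate-zero n)))
                                 (sum-replicate-zero n))
                          (within true)) ⟩
    (E + 2 * E) + (0 + E)
  ≡⟨ solve 1 (λ e → (e :+ con 2 :* e) :+ (con 0 :+ e) := con 4 :* e) refl E ⟩
    4 * E ∎
  where
  open ≡-Reasoning
  E : ℕ
  E = edgeCount G
  F : Fin (n + n) → Fin (n + n) → ℕ
  F x y = ind ((toℕ x <ᵇ toℕ y) ∧ adj G (original x) (original y))
  split-inner : ∀ s → ∑[ u < n ] ∑[ y < n + n ] F (copy u s) y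
    ≡ ∑[ u < n ] ∑[ v < n ] F (copy u s) (copy v false) + ∑[ u < n ] ∑[ v < n ] F (copy u s) (copy v true)
  split-inner s = trans (sum-cong-≗ {n} (λ u → sum-↑ n (F (copy u s))))
                        (∑-distrib-+ {n} (λ u → ∑[ v < n ] F (copy u s) (copy v false)) (λ u → ∑[ v < n ] F (copy u s) (copy v true)))
  position : ∀ (u : Fin n) s → toℕ (copy u s) ≡ (if s then n + toℕ u else toℕ u)
  position u false = toℕ-↑ˡ u n
  position u true  = toℕ-↑ʳ n u
  adj-copies : ∀ u v s t → adj G (original (copy u s)) (original (copy v t)) ≡ adj G u v
  adj-copies u v s t = cong₂ (adj G) (original-copy u s) (original-copy v t)
  within : ∀ s → ∑[ u < n ] ∑[ v < n ] F (copy u s) (copy v s) ≡ E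
  within s = trans (sum-cong-≗ {n} (λ u → sum-cong-≗ {n} (λ v →
      cong₂ (λ b c → ind (b ∧ c)) (same-order s u v) (adj-copies u v s s)))) (sym (edgeCount-∑ G))
    where
    same-order : ∀ s u v → (toℕ (copy u s) <ᵇ toℕ (copy v s)) ≡ (toℕ u <ᵇ toℕ v)
    same-order false u v = cong₂ _<ᵇ_ (toℕ-↑ˡ u n) (toℕ-↑ˡ v n)
    same-order true  u v = trans (cong₂ _<ᵇ_ (toℕ-↑ʳ n u) (toℕ-↑ʳ n v)) (<ᵇ-+ˡ n (toℕ u) (toℕ v))
  u′<v″ : ∀ (u v : Fin n) → toℕ (copy u false) < toℕ (copy v true)
  u′<v″ u v = subst₂ _<_ (sym (toℕ-↑ˡ u n)) (sym (toℕ-↑ʳ n v)) (≤-trans (toℕ<n u) (m≤m+n n (toℕ v)))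
  upward : ∀ u v → F (copy u false) (copy v true) ≡ ind (adj G u v)
  upward u v = cong₂ (λ b c → ind (b ∧ c)) (<ᵇ-true (u′<v″ u v)) (adj-copies u v false true)
  downward : ∀ u v → F (copy u true) (copy v false) ≡ 0
  downward u v = cong (λ b → ind (b ∧ adj G (original (copy u true)) (original (copy v false))))
                      (<ᵇ-false (<⇒≯ (u′<v″ v u)))

adj-sym-T : ∀ {n} (G : Graph n) {a b} → T (adj G a b) → T (adj G b a)
adj-sym-T G {a} {b} = subst T (adj-sym G a b)

interlace-adj : ∀ {n} (G : Graph n) {a b} → T (adj G a b) → ∀ s t → T (adj (interlace G) (copy a s) (copy b t))
interlace-adj G {a} {b} a~b s t =
  subst₂ (λ u v → T (adj G u v)) (sym (original-copy a s)) (sym (original-copy b t)) a~b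

reach-trans : ∀ {m} {H : Graph m} {u w v} → Reach H u w → Reach H w v → Reach H u v
reach-trans here         r′ = r′
reach-trans (step e r) r′ = step e (reach-trans r r′)

-- In a connected graph with at least two vertices, every vertex has a neighbour:
-- the walk to any other vertex starts with an edge.
has-neighbour : ∀ {n} (G : Graph n) → Connected G → NonTrivial G → ∀ x → ∃[ y ] T (adj G x y)
has-neighbour G connected (s≤s (s≤s _)) x = first-step (connected x (other x)) (other-≢ x)
  where
  other : ∀ {m} → Fin (suc (suc m)) → Fin (suc (suc m))
  other zero    = suc zero
  other (suc _) = zero
  other-≢ : ∀ {m} (x : Fin (suc (suc m))) → x ≢ other x
  other-≢ zero    ()
  other-≢ (suc _) ()
  first-step : ∀ {u v} → Reach G u v → u ≢ v → ∃[ w ] T (adj G u w)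
  first-step here       u≢u = ⊥-elim (u≢u refl)
  first-step (step e _) _   = _ , e

lift : ∀ {n} (G : Graph n) {u v} → Reach G u v → ∀ s → Reach (interlace G) (copy u s) (copy v s)
lift G here       s = here
lift G (step e r) s = step (interlace-adj G e s s) (lift G r s)

-- If G is connected and non-trivial then so is G[:]: walk within one copy, and
-- cross between a′ and a″ through a neighbour b of a (a′ – b″ – a″ or a″ – b′ – a′).
interlace-connected : ∀ {n} (G : Graph n) → Connected G → NonTrivial G → Connected (interlace G)
interlace-connected {n} G connected nontrivial x y =
  subst₂ (Reach (interlace G)) (copy-coordinates {n} x) (copy-coordinates {n} y)
    (reach-trans (cross (original x) (side {n} x) (side {n} y))
                 (lift G (connected (original x) (original y)) (side {n} y)))
  where
  cross : ∀ a s t → Reach (interlace G) (copy a s) (copy a t)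
  cross a s t with has-neighbour G connected nontrivial a
  ... | b , a~b = step (interlace-adj G a~b s (not t)) (step (interlace-adj G (adj-sym-T G a~b) (not t) t) here)

hub-connected : ∀ {m} (G : Graph (suc m)) → (∀ i → T (adj G zero (suc i))) → Connected G
hub-connected G hub u v = reach-trans (to-hub u) (from-hub v)
  where
  to-hub : ∀ u → Reach G u zero
  to-hub zero    = here
  to-hub (suc i) = step (adj-sym-T G (hub i)) here
  from-hub : ∀ v → Reach G zero v
  from-hub zero    = here
  from-hub (suc i) = step (hub i) here

Distinct4-≡ : ∀ {m} (H : Graph m) {a b c d a′ b′ c′ d′} → a ≡ a′ → b ≡ b′ → c ≡ c′ → d ≡ d′ →
  Distinct4 H a b c d → Distinct4 H a′ b′ c′ d′
Distinct4-≡ H refl refl refl refl distinct = distinct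

-- Euler's relation V - E + F = 2 - 2g for V = 2n, E = 4e, F = 2e and the
-- genus g = (e + 1) - n, valid whenever n ≤ e + 1.
euler-count : ∀ n e → n ≤ e + 1 → (n + n) + 2 * e + 2 * ((e + 1) ∸ n) ≡ 2 + 4 * e
euler-count n e n≤e+1 = begin
    (n + n) + 2 * e + 2 * g
  ≡⟨ solve 3 (λ n e g → (n :+ n) :+ con 2 :* e :+ con 2 :* g := con 2 :* (n :+ g) :+ con 2 :* e) refl n e g ⟩
    2 * (n + g) + 2 * e
  ≡⟨ cong (λ m → 2 * m + 2 * e) (m+[n∸m]≡n n≤e+1) ⟩
    2 * (e + 1) + 2 * e
  ≡⟨ solve 1 (λ e → con 2 :* (e :+ con 1) :+ con 2 :* e := con 2 :+ con 4 :* e) refl e ⟩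
    2 + 4 * e ∎
  where
  open ≡-Reasoning
  g : ℕ
  g = (e + 1) ∸ n

-- List the neighbours of a as
-- nbr a 0, …, nbr a (deg a - 1).  Around a′ the rotation is
--   w′, w″, (prev w)′, (prev w)″, …
-- and around a″ it runs in the opposite direction,
--   w″, w′, (next w)″, (next w)′, …
-- where prev/next are taken in the cyclic order of the neighbours of a.
-- Tracing faces, a′ → w′ is followed by w′ → a″, a″ → c″ and c″ → a′ where
-- c is the neighbour after w: every face is the 4-circuit a′ w′ a″ c″, and the
-- faces correspond to the darts a → w of G (their unique arc inside G′).
module Embedding {n : ℕ} (G : Graph n) where

  deg : Fin n → ℕ
  deg a = count (adj G a)

  nbr : (a : Fin n) → Fin (deg a) → Fin n
  nbr a = select (adj G a)

  nbr-adj : ∀ a k → T (adj G a (nbr a k))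
  nbr-adj a = select-sat (adj G a)

  slot : (a w : Fin n) → .(T (adj G a w)) → Fin (deg a)
  slot a = index (adj G a)

  nbr-slot : ∀ a w .(a~w : T (adj G a w)) → nbr a (slot a w a~w) ≡ w
  nbr-slot a = select-index (adj G a)

  slot-nbr : ∀ a k .(a~w : T (adj G a (nbr a k))) → slot a (nbr a k) a~w ≡ k
  slot-nbr a = index-select (adj G a)

  turnNbr : Bool → (a w : Fin n) → .(T (adj G a w)) → Fin n
  turnNbr s a w a~w = nbr a (turn s (slot a w a~w))

  turnNbr-inverse : ∀ s a w .(a~w : T (adj G a w)) .(a~c : T (adj G a (turnNbr s a w a~w))) →
    turnNbr (not s) a (turnNbr s a w a~w) a~c ≡ w
  turnNbr-inverse s a w a~w a~c = begin
      nbr a (turn (not s) (slot a (nbr a (turn s (slot a w a~w))) a~c))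
    ≡⟨ cong (nbr a ∘ turn (not s)) (slot-nbr a _ a~c) ⟩
      nbr a (turn (not s) (turn s (slot a w a~w)))
    ≡⟨ cong (nbr a) (turn-inverse s _) ⟩
      nbr a (slot a w a~w)
    ≡⟨ nbr-slot a w a~w ⟩
      w ∎
    where open ≡-Reasoning

  -- The darts of G[:] in coordinates: a dart a → w of G with the copies s, t
  -- of its ends (false for G′, true for G″).
  record Arc : Set where
    constructor arc
    field
      src     : Fin n
      srcSide : Bool
      dst     : Fin n
      dstSide : Bool
      .src~dst : T (adj G src dst)
  open Arc

  adjacent : (x : Arc) → T (adj G (src x) (dst x))
  adjacent (arc a s w t e) = recover e

  arc-≡ : ∀ {a a′ s s′ w w′ t t′} → a ≡ a′ → s ≡ s′ → w ≡ w′ → t ≡ t′ →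
    .(e : T (adj G a w)) .(e′ : T (adj G a′ w′)) → arc a s w t e ≡ arc a′ s′ w′ t′ e′
  arc-≡ refl refl refl refl _ _ = refl

  arc-dst : ∀ {a s w w′ t} → w ≡ w′ → .(e : T (adj G a w)) .(e′ : T (adj G a w′)) → arc a s w t e ≡ arc a s w′ t e′
  arc-dst w≡w′ = arc-≡ refl refl w≡w′ refl

  corner : Arc → Fin n × Bool
  corner x = src x , srcSide x

  -- The rotation: a settled arc (both ends on the same side) is followed by the
  -- arc to the other copy of the same neighbour, which is followed by the
  -- settled arc to the neighbour turned by one step.
  rot : Arc → Arc
  rot (arc a false w false e) = arc a false w true e
  rot (arc a true  w true  e) = arc a true w false e
  rot (arc a false w true  e) = arc a false (turnNbr false a w e) false (nbr-adj a _)
  rot (arc a true  w false e) = arc a true (turnNbr true a w e) true (nbr-adj a _)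

  rot-settled : ∀ a s w .(e : T (adj G a w)) → rot (arc a s w s e) ≡ arc a s w (not s) e
  rot-settled a false w e = refl
  rot-settled a true  w e = refl

  rot-unsettled : ∀ a s w .(e : T (adj G a w)) → rot (arc a s w (not s) e) ≡ arc a s (turnNbr s a w e) s (nbr-adj a _)
  rot-unsettled a false w e = refl
  rot-unsettled a true  w e = refl

  rot-corner : ∀ x → corner (rot x) ≡ corner x
  rot-corner (arc a false w false e) = refl
  rot-corner (arc a true  w true  e) = refl
  rot-corner (arc a false w true  e) = refl
  rot-corner (arc a true  w false e) = refl

  rot⁻¹ : Arc → Arc
  rot⁻¹ (arc a false w true  e) = arc a false w false e
  rot⁻¹ (arc a true  w false e) = arc a true w true e
  rot⁻¹ (arc a false w false e) = arc a false (turnNbr true a w e) true (nbr-adj a _)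
  rot⁻¹ (arc a true  w true  e) = arc a true (turnNbr false a w e) false (nbr-adj a _)

  rot⁻¹-rot : ∀ x → rot⁻¹ (rot x) ≡ x
  rot⁻¹-rot (arc a false w false e) = refl
  rot⁻¹-rot (arc a true  w true  e) = refl
  rot⁻¹-rot (arc a false w true  e) = arc-dst (turnNbr-inverse false a w e _) _ e
  rot⁻¹-rot (arc a true  w false e) = arc-dst (turnNbr-inverse true a w e _) _ e

  rot-twice : ∀ a s r k → iter (rot ∘ rot) r (arc a s (nbr a k) s (nbr-adj a k))
                          ≡ arc a s (nbr a (iter (turn s) r k)) s (nbr-adj a _)
  rot-twice a s zero    k = refl
  rot-twice a s (suc r) k = begin
      rot (rot (iter (rot ∘ rot) r (arc a s (nbr a k) s _)))
    ≡⟨ cong (rot ∘ rot) (rot-twice a s r k) ⟩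
      rot (rot (arc a s (nbr a j) s _))
    ≡⟨ cong rot (rot-settled a s (nbr a j) _) ⟩
      rot (arc a s (nbr a j) (not s) _)
    ≡⟨ rot-unsettled a s (nbr a j) _ ⟩
      arc a s (turnNbr s a (nbr a j) (nbr-adj a j)) s _
    ≡⟨ arc-dst (cong (nbr a ∘ turn s) (slot-nbr a j _)) _ _ ⟩
      arc a s (nbr a (turn s j)) s _ ∎
    where
    open ≡-Reasoning
    j : Fin (deg a)
    j = iter (turn s) r k

  from-settled : ∀ a s w .(e : T (adj G a w)) y → corner y ≡ (a , s) → ∃[ k ] iter rot k (arc a s w s e) ≡ y
  from-settled a s w e (arc .a .s w₂ t₂ e₂) refl with turn-transitive s (slot a w e) (slot a w₂ e₂)
  ... | r , turned = finish (every-side s t₂)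
    where
    reach-settled : iter rot (r + r) (arc a s w s e) ≡ arc a s w₂ s e₂
    reach-settled = begin
        iter rot (r + r) (arc a s w s e)
      ≡⟨ sym (iter-twice rot r _) ⟩
        iter (rot ∘ rot) r (arc a s w s e)
      ≡⟨ cong (iter (rot ∘ rot) r) (arc-dst (sym (nbr-slot a w e)) e (nbr-adj a _)) ⟩
        iter (rot ∘ rot) r (arc a s (nbr a (slot a w e)) s _)
      ≡⟨ rot-twice a s r (slot a w e) ⟩
        arc a s (nbr a (iter (turn s) r (slot a w e))) s _
      ≡⟨ arc-dst (trans (cong (nbr a) turned) (nbr-slot a w₂ e₂)) _ _ ⟩
        arc a s w₂ s e₂ ∎
      where open ≡-Reasoning
    finish : t₂ ≡ s ⊎ t₂ ≡ not s → ∃[ k ] iter rot k (arc a s w s e) ≡ arc a s w₂ t₂ e₂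
    finish (inj₁ refl) = r + r , reach-settled
    finish (inj₂ refl) = suc (r + r) , trans (cong rot reach-settled) (rot-settled a s w₂ e₂)

  rot-transitive : ∀ x y → corner x ≡ corner y → ∃[ k ] iter rot k x ≡ y
  rot-transitive (arc a s w t e) y same with every-side s t
  ... | inj₁ refl = from-settled a s w e y (sym same)
  ... | inj₂ refl with from-settled a s (turnNbr s a w e) (nbr-adj a _) y (sym same)
  ...   | k , reached = k + 1 , trans (iter-+ rot k 1 _) (trans (cong (iter rot k) (rot-unsettled a s w e)) reached)

  flip : Arc → Arc
  flip (arc a s w t e) = arc w t a s (adj-sym-T G e)

  trace : Arc → Arc
  trace x = rot (flip x)

  -- The face through x contains exactly one arc inside G′, `base x`, and x is
  -- reached from it after `offset x` < 4 tracing steps.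
  base : Arc → Arc
  base (arc a false w false e) = arc a false w false e
  base (arc a false w true  e) = arc w false a false (adj-sym-T G e)
  base (arc a true  w true  e) = arc a false (turnNbr false a w e) false (nbr-adj a _)
  base (arc a true  w false e) = arc w false (turnNbr false w a (adj-sym-T G e)) false (nbr-adj w _)

  offset : Arc → ℕ
  offset (arc a false w false e) = 0
  offset (arc a false w true  e) = 1
  offset (arc a true  w true  e) = 2
  offset (arc a true  w false e) = 3

  offset≤4 : ∀ x → offset x ≤ 4
  offset≤4 (arc a false w false e) = z≤n
  offset≤4 (arc a false w true  e) = s≤s z≤n
  offset≤4 (arc a true  w true  e) = s≤s (s≤s z≤n)
  offset≤4 (arc a true  w false e) = s≤s (s≤s (s≤s z≤n))

  trace-from-base : ∀ x → iter trace (offset x) (base x) ≡ x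
  trace-from-base (arc a false w false e) = refl
  trace-from-base (arc a false w true  e) = refl
  trace-from-base (arc a true  w true  e) = arc-dst (turnNbr-inverse false a w e _) _ e
  trace-from-base (arc a true  w false e) = arc-≡ (turnNbr-inverse false w a (adj-sym-T G (recover e)) _) refl refl refl _ e

  base-trace : ∀ x → base (trace x) ≡ base x
  base-trace (arc a false w false e) = refl
  base-trace (arc a false w true  e) = arc-dst (turnNbr-inverse true w a (adj-sym-T G (recover e)) _) _ _
  base-trace (arc a true  w true  e) = refl
  base-trace (arc a true  w false e) = refl

  base-in-G′ : ∀ x → base x ≡ arc (src (base x)) false (dst (base x)) false (adjacent (base x))
  base-in-G′ (arc a false w false e) = refl
  base-in-G′ (arc a false w true  e) = refl
  base-in-G′ (arc a true  w true  e) = refl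
  base-in-G′ (arc a true  w false e) = refl

  -- The face of a′ → w′ is a′ → w′ → a″ → c″ → a′ with c the neighbour of a after w.
  settled-period : ∀ a w .(e : T (adj G a w)) → iter trace 4 (arc a false w false e) ≡ arc a false w false e
  settled-period a w e = arc-dst (turnNbr-inverse true a w e _) _ e

  trace-period : ∀ x → iter trace 4 x ≡ x
  trace-period x = begin
      iter trace 4 x                         ≡⟨ cong (iter trace 4) (sym (trace-from-base x)) ⟩
      iter trace 4 (iter trace i (base x))   ≡⟨ sym (iter-+ trace 4 i _) ⟩
      iter trace (4 + i) (base x)            ≡⟨ cong (λ k → iter trace k (base x)) (+-comm 4 i) ⟩
      iter trace (i + 4) (base x)            ≡⟨ iter-+ trace i 4 _ ⟩
      iter trace i (iter trace 4 (base x))   ≡⟨ cong (iter trace i ∘ iter trace 4) (base-in-G′ x) ⟩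
      iter trace i (iter trace 4 b′)         ≡⟨ cong (iter trace i) (settled-period (src (base x)) (dst (base x)) _) ⟩
      iter trace i b′                        ≡⟨ cong (iter trace i) (sym (base-in-G′ x)) ⟩
      iter trace i (base x)                  ≡⟨ trace-from-base x ⟩
      x                                      ∎
    where
    open ≡-Reasoning
    i : ℕ
    i = offset x
    b′ : Arc
    b′ = arc (src (base x)) false (dst (base x)) false (adjacent (base x))

  -- Faces are numbered by the darts of G, i.e. by pairs (a , slot of w at a).
  settledArc : Σ (Fin n) (Fin ∘ deg) → Arc
  settledArc (a , k) = arc a false (nbr a k) false (nbr-adj a k)

  dartIndex : Arc → Fin (sum deg)
  dartIndex z = fromΣ deg (src z , slot (src z) (dst z) (adjacent z))

  faceOf : Arc → Fin (sum deg)
  faceOf x = dartIndex (base x)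

  base-from-face : ∀ x → settledArc (toΣ deg (faceOf x)) ≡ base x
  base-from-face x = begin
      settledArc (toΣ deg (faceOf x))
    ≡⟨ cong settledArc (toΣ-fromΣ deg _) ⟩
      arc (src (base x)) false (nbr (src (base x)) (slot (src (base x)) (dst (base x)) _)) false _
    ≡⟨ arc-dst (nbr-slot _ _ (adjacent (base x))) _ _ ⟩
      arc (src (base x)) false (dst (base x)) false (adjacent (base x))
    ≡⟨ sym (base-in-G′ x) ⟩
      base x ∎
    where open ≡-Reasoning

  faceOf-settled : ∀ i → faceOf (settledArc (toΣ deg i)) ≡ i
  faceOf-settled i = trans (cong (λ k → fromΣ deg (proj₁ (toΣ deg i) , k)) (slot-nbr _ _ _)) (fromΣ-toΣ deg i)

  same-face : ∀ x y → (∃[ k ] iter trace k x ≡ y) → faceOf x ≡ faceOf y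
  same-face x y (k , reached) = trans (cong dartIndex (sym (base-iter k))) (cong faceOf reached)
    where
    base-iter : ∀ k → base (iter trace k x) ≡ base x
    base-iter zero    = refl
    base-iter (suc k) = trans (base-trace (iter trace k x)) (base-iter k)

  face-orbit : ∀ x y → faceOf x ≡ faceOf y → ∃[ k ] iter trace k x ≡ y
  face-orbit x y same = offset y + (4 ∸ offset x) , (begin
      iter trace (offset y + (4 ∸ offset x)) x
    ≡⟨ iter-+ trace (offset y) (4 ∸ offset x) x ⟩
      iter trace (offset y) (iter trace (4 ∸ offset x) x)
    ≡⟨ cong (iter trace (offset y) ∘ iter trace (4 ∸ offset x)) (sym (trace-from-base x)) ⟩
      iter trace (offset y) (iter trace (4 ∸ offset x) (iter trace (offset x) (base x)))
    ≡⟨ cong (iter trace (offset y)) (sym (iter-+ trace (4 ∸ offset x) (offset x) (base x))) ⟩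
      iter trace (offset y) (iter trace ((4 ∸ offset x) + offset x) (base x))
    ≡⟨ cong (λ k → iter trace (offset y) (iter trace k (base x))) (m∸n+n≡m (offset≤4 x)) ⟩
      iter trace (offset y) (iter trace 4 (base x))
    ≡⟨ cong (iter trace (offset y)) (trace-period (base x)) ⟩
      iter trace (offset y) (base x)
    ≡⟨ cong (iter trace (offset y)) same-base ⟩
      iter trace (offset y) (base y)
    ≡⟨ trace-from-base y ⟩
      y ∎)
    where
    open ≡-Reasoning
    same-base : base x ≡ base y
    same-base = trans (sym (base-from-face x)) (trans (cong (settledArc ∘ toΣ deg) same) (base-from-face y))

  -- The four corners of every face are distinct vertices of G[:]: consecutive
  -- corners are adjacent or on different sides, opposite ones on different sides.
  adjacent-≢ : ∀ {a w} → T (adj G a w) → a ≢ w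
  adjacent-≢ {a} a~w refl = subst T (adj-irrefl G a) a~w

  other-vertex : ∀ {a b : Fin n} {s t : Bool} → a ≢ b → (a , s) ≢ (b , t)
  other-vertex a≢b eq = a≢b (cong proj₁ eq)

  other-side : ∀ {a b : Fin n} {s t : Bool} → s ≢ t → (a , s) ≢ (b , t)
  other-side s≢t eq = s≢t (cong proj₂ eq)

  CornersApart : Arc → Set
  CornersApart x = c 0 ≢ c 1 × c 0 ≢ c 2 × c 0 ≢ c 3 × c 1 ≢ c 2 × c 1 ≢ c 3 × c 2 ≢ c 3
    where
    c : ℕ → Fin n × Bool
    c k = corner (iter trace k x)

  corners-apart : ∀ x → CornersApart x
  corners-apart (arc a false w false e) =
    other-vertex (adjacent-≢ (recover e)) , other-side (λ ()) , other-side (λ ()) ,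
    other-side (λ ()) , other-side (λ ()) , other-vertex (adjacent-≢ (nbr-adj a _))
  corners-apart (arc a false w true e) =
    other-side (λ ()) , other-side (λ ()) , other-vertex (adjacent-≢ (recover e)) ,
    other-vertex (adjacent-≢ (nbr-adj w _)) , other-side (λ ()) , other-side (λ ())
  corners-apart (arc a true w true e) =
    other-vertex (adjacent-≢ (recover e)) , other-side (λ ()) , other-side (λ ()) ,
    other-side (λ ()) , other-side (λ ()) , other-vertex (adjacent-≢ (nbr-adj a _))
  corners-apart (arc a true w false e) =
    other-side (λ ()) , other-side (λ ()) , other-vertex (adjacent-≢ (recover e)) ,
    other-vertex (adjacent-≢ (nbr-adj w _)) , other-side (λ ()) , other-side (λ ())

  vertexOf : Arc → Fin (n + n)
  vertexOf x = copy (src x) (srcSide x)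

  corners-distinct : ∀ x → Distinct4 (interlace G) (vertexOf x) (vertexOf (trace x))
                                                   (vertexOf (iter trace 2 x)) (vertexOf (iter trace 3 x))
  corners-distinct x with corners-apart x
  ... | d01 , d02 , d03 , d12 , d13 , d23 =
    apart 0 1 d01 , apart 0 2 d02 , apart 0 3 d03 , apart 1 2 d12 , apart 1 3 d13 , apart 2 3 d23
    where
    apart : ∀ k l → corner (iter trace k x) ≢ corner (iter trace l x) →
            vertexOf (iter trace k x) ≢ vertexOf (iter trace l x)
    apart k l ck≢cl eq = ck≢cl (copy-injective _ _ _ _ eq)

  toArc : Dart (interlace G) → Arc
  toArc ((x , y) , e) = arc (original x) (side {n} x) (original y) (side {n} y) e

  fromArc : Arc → Dart (interlace G)
  fromArc x = (vertexOf x , vertexOf (flip x)) , interlace-adj G (adjacent x) (srcSide x) (dstSide x)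

  toArc-fromArc : ∀ x → toArc (fromArc x) ≡ x
  toArc-fromArc (arc a s w t e) = arc-≡ (original-copy a s) (side-copy a s) (original-copy w t) (side-copy w t) _ e

  dart-≡ : ∀ {d d′ : Dart (interlace G)} → proj₁ d ≡ proj₁ d′ → d ≡ d′
  dart-≡ {xy , e} {.xy , e′} refl = cong (xy ,_) (T-irrelevant e e′)

  fromArc-toArc : ∀ d → fromArc (toArc d) ≡ d
  fromArc-toArc ((x , y) , e) = dart-≡ (cong₂ _,_ (copy-coordinates {n} x) (copy-coordinates {n} y))

  conjugate : ∀ (f : Arc → Arc) k d → iter (fromArc ∘ f ∘ toArc) k d ≡ fromArc (iter f k (toArc d))
  conjugate = iter-conjugate toArc fromArc toArc-fromArc fromArc-toArc

  ρ′ : Dart (interlace G) → Dart (interlace G)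
  ρ′ = fromArc ∘ rot ∘ toArc

  ρ′-tail : ∀ d → tail (interlace G) (ρ′ d) ≡ tail (interlace G) d
  ρ′-tail d = trans (cong (λ c → copy (proj₁ c) (proj₂ c)) (rot-corner (toArc d))) (copy-coordinates {n} (proj₁ (proj₁ d)))

  ρ′-injective : ∀ d d′ → ρ′ d ≡ ρ′ d′ → d ≡ d′
  ρ′-injective d d′ eq = begin
      d                                      ≡⟨ sym (fromArc-toArc d) ⟩
      fromArc (toArc d)                      ≡⟨ cong fromArc (sym (rot⁻¹-rot (toArc d))) ⟩
      fromArc (rot⁻¹ (rot (toArc d)))        ≡⟨ cong (fromArc ∘ rot⁻¹) (sym (toArc-fromArc (rot (toArc d)))) ⟩
      fromArc (rot⁻¹ (toArc (ρ′ d)))         ≡⟨ cong (fromArc ∘ rot⁻¹ ∘ toArc) eq ⟩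
      fromArc (rot⁻¹ (toArc (ρ′ d′)))        ≡⟨ cong (fromArc ∘ rot⁻¹) (toArc-fromArc (rot (toArc d′))) ⟩
      fromArc (rot⁻¹ (rot (toArc d′)))       ≡⟨ cong fromArc (rot⁻¹-rot (toArc d′)) ⟩
      fromArc (toArc d′)                     ≡⟨ fromArc-toArc d′ ⟩
      d′                                     ∎
    where open ≡-Reasoning

  rotation : RotationSystem (interlace G)
  rotation = record
    { ρ        = ρ′
    ; ρ-tail   = ρ′-tail
    ; ρ-inj    = λ d d′ eq → cong proj₁ (ρ′-injective d d′ (dart-≡ {ρ′ d} {ρ′ d′} eq))
    ; ρ-cyclic = cyclic
    }
    where
    cyclic : ∀ d d′ → tail (interlace G) d ≡ tail (interlace G) d′ → ∃[ k ] proj₁ (iter ρ′ k d) ≡ proj₁ d′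
    cyclic d d′ same-tail with rot-transitive (toArc d) (toArc d′) (cong (λ v → original v , side {n} v) same-tail)
    ... | k , reached = k , cong proj₁ (trans (conjugate rot k d) (trans (cong fromArc reached) (fromArc-toArc d′)))

  trace-orbit : ∀ k d → iter (faceStep (interlace G) rotation) k d ≡ fromArc (iter trace k (toArc d))
  trace-orbit = conjugate trace

  face-surjective : ∀ i → ∃[ d ] faceOf (toArc d) ≡ i
  face-surjective i = fromArc (settledArc (toΣ deg i)) ,
    trans (cong faceOf (toArc-fromArc (settledArc (toΣ deg i)))) (faceOf-settled i)

  face-orbit-dart : ∀ d d′ → faceOf (toArc d) ≡ faceOf (toArc d′) →
    ∃[ k ] proj₁ (iter (faceStep (interlace G) rotation) k d) ≡ proj₁ d′
  face-orbit-dart d d′ same = k , cong proj₁ (trans (trace-orbit k d) (trans (cong fromArc reached) (fromArc-toArc d′)))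
    where
    k : ℕ
    k = proj₁ (face-orbit (toArc d) (toArc d′) same)
    reached : iter trace k (toArc d) ≡ toArc d′
    reached = proj₂ (face-orbit (toArc d) (toArc d′) same)

  same-face-dart : ∀ d d′ → (∃[ k ] proj₁ (iter (faceStep (interlace G) rotation) k d) ≡ proj₁ d′) →
    faceOf (toArc d) ≡ faceOf (toArc d′)
  same-face-dart d d′ (k , reached) = same-face (toArc d) (toArc d′) (k , (begin
      iter trace k (toArc d)                       ≡⟨ sym (toArc-fromArc (iter trace k (toArc d))) ⟩
      toArc (fromArc (iter trace k (toArc d)))     ≡⟨ cong toArc (sym (trace-orbit k d)) ⟩
      toArc (iter (faceStep (interlace G) rotation) k d) ≡⟨ cong toArc (dart-≡ {iter (faceStep (interlace G) rotation) k d} {d′} reached) ⟩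
      toArc d′                                     ∎))
    where open ≡-Reasoning

  faces : Faces (interlace G) rotation (sum deg)
  faces = record
    { face      = faceOf ∘ toArc
    ; face-surj = face-surjective
    ; face-orb₁ = face-orbit-dart
    ; face-orb₂ = same-face-dart
    }

  all-faces-simple : AllFacesSimple4 (interlace G) rotation
  all-faces-simple d =
    cong proj₁ (trans (trace-orbit 4 d) (trans (cong fromArc (trace-period (toArc d))) (fromArc-toArc d))) ,
    Distinct4-≡ (interlace G) (corner-at 0) (corner-at 1) (corner-at 2) (corner-at 3) (corners-distinct (toArc d))
    where
    corner-at : ∀ k → vertexOf (iter trace k (toArc d)) ≡ tail (interlace G) (iter (faceStep (interlace G) rotation) k d)
    corner-at k = cong (tail (interlace G)) (sym (trace-orbit k d))

  -- The embedding is a quadrangulation of the surface of genus β(G), provided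
  -- G[:] is connected and β(G) is the true cycle rank, i.e. n ≤ |E(G)| + 1.
  quadrangulation : Connected (interlace G) → n ≤ edgeCount G + 1 → Quadrangulation (interlace G) (β G)
  quadrangulation connected n≤e+1 =
    connected , rotation , sum deg , faces , euler , all-faces-simple
    where
    E : ℕ
    E = edgeCount G
    euler : (n + n) + sum deg + 2 * β G ≡ 2 + edgeCount (interlace G)
    euler = begin
        (n + n) + sum deg + 2 * ((E + 1) ∸ n)  ≡⟨ cong (λ f → (n + n) + f + 2 * ((E + 1) ∸ n)) (handshake G) ⟩
        (n + n) + 2 * E + 2 * ((E + 1) ∸ n)    ≡⟨ euler-count n E n≤e+1 ⟩
        2 + 4 * E                              ≡⟨ cong (2 +_) (sym (interlace-edgeCount G)) ⟩
        2 + edgeCount (interlace G)            ∎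
      where open ≡-Reasoning

threshold-adj : (ℕ → ℕ) → ℕ → ℕ → Bool
threshold-adj c u v = ((u <ᵇ v) ∧ (u <ᵇ c v)) ∨ ((v <ᵇ u) ∧ (v <ᵇ c u))

threshold : (ℕ → ℕ) → (p : ℕ) → Graph p
threshold c p = record
  { adj        = λ u v → threshold-adj c (toℕ u) (toℕ v)
  ; adj-sym    = λ u v → ∨-comm ((toℕ u <ᵇ toℕ v) ∧ (toℕ u <ᵇ c (toℕ v))) _
  ; adj-irrefl = λ u → no-loop (toℕ u)
  }
  where
  no-loop : ∀ u → ((u <ᵇ u) ∧ (u <ᵇ c u)) ∨ ((u <ᵇ u) ∧ (u <ᵇ c u)) ≡ false
  no-loop u rewrite <ᵇ-false (<-irrefl {u} refl) = refl

smaller-neighbour : ∀ (c : ℕ → ℕ) → (∀ v → c v ≤ v) → ∀ u v →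
  ind ((u <ᵇ v) ∧ (((u <ᵇ v) ∧ (u <ᵇ c v)) ∨ ((v <ᵇ u) ∧ (v <ᵇ c u)))) ≡ ind (u <ᵇ c v)
smaller-neighbour c c≤ u v with u <? v
... | yes u<v rewrite <ᵇ-true u<v | <ᵇ-false (<⇒≯ u<v) = cong ind (∨-identityʳ (u <ᵇ c v))
... | no  u≮v rewrite <ᵇ-false u≮v | <ᵇ-false (λ u<cv → u≮v (<-≤-trans u<cv (c≤ v))) = refl

count-below : ∀ p c → ∑[ u < p ] ind (toℕ u <ᵇ c) ≡ c ⊓ p
count-below zero    c       = sym (⊓-zeroʳ c)
count-below (suc p) zero    = sum-replicate-zero p
count-below (suc p) (suc c) = cong suc (count-below p c)

threshold-edgeCount : ∀ (c : ℕ → ℕ) p → (∀ v → c v ≤ v) → edgeCount (threshold c p) ≡ ∑[ v < p ] c (toℕ v)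
threshold-edgeCount c p c≤ = begin
    edgeCount (threshold c p)
  ≡⟨ edgeCount-∑ (threshold c p) ⟩
    ∑[ u < p ] ∑[ v < p ] ind ((toℕ u <ᵇ toℕ v) ∧ threshold-adj c (toℕ u) (toℕ v))
  ≡⟨ ∑-comm {p} {p} (λ u v → ind ((toℕ u <ᵇ toℕ v) ∧ threshold-adj c (toℕ u) (toℕ v))) ⟩
    ∑[ v < p ] ∑[ u < p ] ind ((toℕ u <ᵇ toℕ v) ∧ threshold-adj c (toℕ u) (toℕ v))
  ≡⟨ sum-cong-≗ {p} (λ v → sum-cong-≗ {p} (λ u → smaller-neighbour c c≤ (toℕ u) (toℕ v))) ⟩
    ∑[ v < p ] ∑[ u < p ] ind (toℕ u <ᵇ c (toℕ v))
  ≡⟨ sum-cong-≗ {p} (λ v → trans (count-below p (c (toℕ v))) (m≤n⇒m⊓n≡m (≤-trans (c≤ (toℕ v)) (<⇒≤ (toℕ<n v))))) ⟩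
    ∑[ v < p ] c (toℕ v) ∎
  where open ≡-Reasoning

tri : ℕ → ℕ
tri zero    = 0
tri (suc k) = tri k + k

tri-double : ∀ k → 2 * tri (suc k) ≡ suc k * k
tri-double zero    = refl
tri-double (suc k) = begin
    2 * (tri (suc k) + suc k)      ≡⟨ *-distribˡ-+ 2 (tri (suc k)) (suc k) ⟩
    2 * tri (suc k) + 2 * suc k    ≡⟨ cong (_+ 2 * suc k) (tri-double k) ⟩
    suc k * k + 2 * suc k          ≡⟨ solve 1 (λ x → (con 1 :+ x) :* x :+ con 2 :* (con 1 :+ x) := (con 2 :+ x) :* (con 1 :+ x)) refl k ⟩
    suc (suc k) * suc k            ∎
  where open ≡-Reasoning

-- Vertex 0 is joined to everything, and vertex k + 1
-- contributes min(k, g - tri k) edges beyond this star, as long as some of the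
-- g extra edges remain to be placed.
spineDown : ℕ → ℕ → ℕ
spineDown g zero    = 0
spineDown g (suc k) = suc (k ⊓ (g ∸ tri k))

spineDown≤ : ∀ g k → spineDown g k ≤ k
spineDown≤ g zero    = z≤n
spineDown≤ g (suc k) = s≤s (m⊓n≤m k _)

spine : ℕ → (p : ℕ) → Graph p
spine g = threshold (spineDown g)

extra-edges : ∀ g t k → g ⊓ t + k ⊓ (g ∸ t) ≡ g ⊓ (t + k)
extra-edges g t k with ≤-total g t
... | inj₁ g≤t rewrite m≤n⇒m⊓n≡m g≤t | m≤n⇒m∸n≡0 g≤t | ⊓-zeroʳ k | m≤n⇒m⊓n≡m (≤-trans g≤t (m≤m+n t k)) = +-identityʳ g
... | inj₂ t≤g = begin
    g ⊓ t + k ⊓ (g ∸ t)        ≡⟨ cong₂ _+_ (m≥n⇒m⊓n≡n t≤g) (⊓-comm k (g ∸ t)) ⟩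
    t + (g ∸ t) ⊓ k            ≡⟨ +-distribˡ-⊓ t (g ∸ t) k ⟩
    (t + (g ∸ t)) ⊓ (t + k)    ≡⟨ cong (_⊓ (t + k)) (m+[n∸m]≡n t≤g) ⟩
    g ⊓ (t + k)                ∎
  where open ≡-Reasoning

spine-degree-sum : ∀ g q → ∑[ v < suc q ] spineDown g (toℕ v) ≡ q + g ⊓ tri q
spine-degree-sum g zero    = sym (⊓-zeroʳ g)
spine-degree-sum g (suc q) = begin
    ∑[ v < suc (suc q) ] spineDown g (toℕ v)
  ≡⟨ sum-init-last (λ v → spineDown g (toℕ v)) ⟩
    ∑[ v < suc q ] spineDown g (toℕ (inject₁ v)) + spineDown g (toℕ (fromℕ (suc q)))
  ≡⟨ cong₂ _+_ (sum-cong-≗ {suc q} (λ v → cong (spineDown g) (toℕ-inject₁ v))) (cong (spineDown g) (toℕ-fromℕ (suc q))) ⟩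
    ∑[ v < suc q ] spineDown g (toℕ v) + suc (q ⊓ (g ∸ tri q))
  ≡⟨ cong (_+ suc (q ⊓ (g ∸ tri q))) (spine-degree-sum g q) ⟩
    q + g ⊓ tri q + suc (q ⊓ (g ∸ tri q))
  ≡⟨ trans (+-suc (q + g ⊓ tri q) _) (cong suc (+-assoc q (g ⊓ tri q) _)) ⟩
    suc q + (g ⊓ tri q + q ⊓ (g ∸ tri q))
  ≡⟨ cong (suc q +_) (extra-edges g (tri q) q) ⟩
    suc q + g ⊓ tri (suc q) ∎
  where open ≡-Reasoning

spine-edgeCount : ∀ g q → g ≤ tri q → edgeCount (spine g (suc q)) ≡ q + g
spine-edgeCount g q g≤tri = begin
    edgeCount (spine g (suc q))                ≡⟨ threshold-edgeCount (spineDown g) (suc q) (spineDown≤ g) ⟩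
    ∑[ v < suc q ] spineDown g (toℕ v)         ≡⟨ spine-degree-sum g q ⟩
    q + g ⊓ tri q                              ≡⟨ cong (q +_) (m≤n⇒m⊓n≡m g≤tri) ⟩
    q + g                                      ∎
  where open ≡-Reasoning

spine-β : ∀ g q → g ≤ tri q → β (spine g (suc q)) ≡ g
spine-β g q g≤tri = begin
    (edgeCount (spine g (suc q)) + 1) ∸ suc q  ≡⟨ cong (λ e → (e + 1) ∸ suc q) (spine-edgeCount g q g≤tri) ⟩
    (q + g + 1) ∸ suc q                        ≡⟨ cong (_∸ suc q) (+-comm (q + g) 1) ⟩
    (q + g) ∸ q                                ≡⟨ m+n∸m≡n q g ⟩
    g                                          ∎
  where open ≡-Reasoning

spine-connected : ∀ g q → Connected (spine g (suc q))
spine-connected g q = hub-connected (spine g (suc q)) (λ i → tt)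

corollary4 : (g p : ℕ) → 2 ≤ p → 2 * g ≤ (p ∸ 1) * (p ∸ 2) →
    Σ ℕ λ n → Σ (Graph n) λ G →
      SpinalQuadrangulation G × β G ≡ g × n + n ≡ 2 * p
corollary4 g (suc (suc r)) nontrivial@(s≤s (s≤s _)) 2g≤ =
  p , G , (nontrivial , connected , Embedding.quadrangulation G connected[:] p≤e+1) ,
  spine-β g (suc r) g≤tri , cong (p +_) (sym (+-identityʳ p))
  where
  p : ℕ
  p = suc (suc r)
  G : Graph p
  G = spine g p
  g≤tri : g ≤ tri (suc r)
  g≤tri = *-cancelˡ-≤ 2 (subst (2 * g ≤_) (sym (tri-double r)) 2g≤)
  connected : Connected G
  connected = spine-connected g (suc r)
  connected[:] : Connected (interlace G)
  connected[:] = interlace-connected G connected nontrivial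
  p≤e+1 : p ≤ edgeCount G + 1
  p≤e+1 = subst (p ≤_) (cong (_+ 1) (sym (spine-edgeCount g (suc r) g≤tri)))
                (subst (_≤ suc r + g + 1) (+-comm (suc r) 1) (+-monoˡ-≤ 1 (m≤m+n (suc r) g)))
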